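{- Let $G=(V,\le,\rho)$ be an ordered directed graph, reflexive or irreflexive, such that $\simeq_G$ has infinitely many equivalence classes. Then either $V$ contains an infinite subset $A$ such that any two distinct vertices of $A$ are $0$-equivalent but not $1$-equivalent, or $V$ contains two disjoint infinite subsets $A_1,A_2$ such that, for $i=1,2$, any two distinct vertices of $A_i$ are $1$-equivalent but not $\simeq_G$-equivalent, and for all distinct $x,y\in A_i$ and $j\ne i$ in $\{1,2\}$, the interval $I_\le(x,y)$ meets $A_j$.
   Context: $\le$ is a linear order on $V$ and $\rho$ a binary relation on $V$ (either reflexive or irreflexive). For $x,y\in V$ and finite $F\subseteq V\setminus\{x,y\}$, $x\simeq_{F,G}y$ means the restrictions of $G$ to $\{x\}\cup F$ and $\{y\}\cup F$ are isomorphic; $x,y$ are $k$-equivalent ($x\simeq_{k,G}y$) if $x\simeq_{F,G}y$ for every $k$-element $F\subseteq V\setminus\{x,y\}$; $x\simeq_G y$ means $x\simeq_{k,G}y$ for every $k\ge 0$. $I_\le(x,y)$ denotes the interval of $\le$ between $x$ and $y$. -}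

module Defs where

open import Data.Nat using (ℕ; suc)
open import Data.Fin using (Fin)
open import Data.Vec using (Vec; _∷_; lookup)
open import Data.List using (List)
open import Data.List.Membership.Propositional using (_∈_)
open import Data.List.Relation.Unary.Any using (Any)
open import Data.Product using (Σ; _×_; ∃)
open import Data.Sum using (_⊎_)
open import Function.Bundles using (_↔_; Inverse)
open import Relation.Nullary using (¬_)
open import Relation.Binary.PropositionalEquality using (_≡_; _≢_)

-- An ordered directed graph G = (V, ≤, ρ): ≤ is a linear order on V
-- (imposed in the statement), ρ an arbitrary binary relation on V.
module OrderedDigraph {V : Set} (_≤_ : V → V → Set) (ρ : V → V → Set) where

  InjVec : ∀ {n} → Vec V n → Set
  InjVec {n} u = (i j : Fin n) → lookup u i ≡ lookup u j → i ≡ j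

  -- The restrictions of G to the (duplicate-free) sets {u_i} and {w_i}
  -- are isomorphic: there is a bijection u_i ↦ w_(σ i) preserving and
  -- reflecting both ≤ and ρ.
  IsoRestr : ∀ {n} → Vec V n → Vec V n → Set
  IsoRestr {n} u w =
    Σ (Fin n ↔ Fin n) λ σ →
      (i j : Fin n) →
        ((lookup u i ≤ lookup u j → lookup w (Inverse.to σ i) ≤ lookup w (Inverse.to σ j))
         × (lookup w (Inverse.to σ i) ≤ lookup w (Inverse.to σ j) → lookup u i ≤ lookup u j))
        × ((ρ (lookup u i) (lookup u j) → ρ (lookup w (Inverse.to σ i)) (lookup w (Inverse.to σ j)))
         × (ρ (lookup w (Inverse.to σ i)) (lookup w (Inverse.to σ j)) → ρ (lookup u i) (lookup u j)))

  -- x ≃_{F,G} y, for F a finite subset of V ∖ {x,y} listed without repetition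
  EquivF : ∀ {k} → V → V → Vec V k → Set
  EquivF x y F = IsoRestr (x ∷ F) (y ∷ F)

  KEquiv : ℕ → V → V → Set
  KEquiv k x y =
    (F : Vec V k) → InjVec F → ((i : Fin k) → (lookup F i ≢ x) × (lookup F i ≢ y)) →
    EquivF x y F

  Equiv : V → V → Set
  Equiv x y = (k : ℕ) → KEquiv k x y

  InfinitelyManyClasses : Set
  InfinitelyManyClasses = ¬ (Σ (List V) λ L → (v : V) → Any (Equiv v) L)

  Interval : V → V → V → Set
  Interval x y z = ((x ≤ z) × (z ≤ y)) ⊎ ((y ≤ z) × (z ≤ x))

Infinite : {V : Set} → (V → Set) → Set
Infinite {V} A = ¬ (Σ (List V) λ L → (v : V) → A v → v ∈ L)

Disjoint : {V : Set} → (V → Set) → (V → Set) → Set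
Disjoint {V} A B = (v : V) → A v → B v → Data.Empty.⊥
  where import Data.Empty

module Submission where

-- Pick vertices v₀, v₁, … in pairwise distinct ≃_G-classes.  Applying the
-- infinite Ramsey theorem for pairs twice, pass to a subsequence that is
-- monotone for ≤ and on which 1-equivalence holds either for every pair or
-- for none.  Any two vertices are 0-equivalent because ρ is reflexive or
-- irreflexive, so in the second case the subsequence itself is the set A.
-- In the first case its terms of even and of odd index form A₁ and A₂: by
-- monotonicity, between two even-indexed terms lies an odd-indexed one and
-- vice versa.

open import Defs
open import Axiom.DoubleNegationElimination using (em⇒dne)
open import Axiom.ExcludedMiddle using (ExcludedMiddle)
open import Data.Bool using (Bool; true; false)
open import Data.Bool.Properties using (¬-not)
open import Data.Fin as Fin using (toℕ)
open import Data.Fin.Properties using (pigeonhole)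
open import Data.List using (List; []; _∷_; length; lookup)
open import Data.Vec using (Vec; []; _∷_)
import Data.Vec as Vec
open import Data.List.Membership.Propositional using (_∈_)
open import Data.List.Relation.Unary.Any as Any using (Any; here; there; index)
open import Data.List.Relation.Unary.Any.Properties using (lookup-index)
open import Data.Nat using (ℕ; zero; suc; _<_; _≤_; _⊔_; _≤′_; ≤′-refl; ≤′-step; _<′_; z≤n; s≤s)
open import Data.Nat.Properties
  using (<-cmp; <-irrefl; <-trans; ≤-refl; n<1+n; suc-injective; <⇒<′; m⊔n≤o⇒m≤o; m⊔n≤o⇒n≤o)
open import Data.Nat.InfinitelyOften using (Inf; commutes-with-∪) renaming (map to Inf-map)
open import Data.Product using (Σ; _×_; ∃; ∃₂; _,_; proj₁; proj₂; swap)
open import Data.Sum as Sum using (_⊎_; inj₁; inj₂)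
open import Data.Empty using (⊥-elim)
open import Data.Unit using (tt)
open import Function using (_∘_; id; const)
open import Function.Definitions using (Injective)
open import Function.Bundles using (Inverse)
open import Function.Properties.Inverse using (↔-refl; ↔-sym)
open import Level using (0ℓ)
open import Relation.Binary.Definitions using (Reflexive; Symmetric; Total; tri<; tri≈; tri>)
open import Relation.Binary.PropositionalEquality using (_≡_; _≢_; refl; sym; trans; cong; subst; subst₂)
open import Relation.Binary.Structures using (IsTotalOrder)
open import Relation.Nullary using (¬_; yes; no; contradiction)
open import Relation.Unary using (Pred; U; ∁; _∩_; _∪_; _⊆_)

Homogeneous : {A : Set} → (A → A → Set) → (ℕ → A) → Set
Homogeneous R s = ∀ {i j} → i < j → R (s i) (s j)

StrictlyIncreasing : (ℕ → ℕ) → Set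
StrictlyIncreasing = Homogeneous _<_

HomogeneousSubsequence : {A : Set} → (A → A → Set) → (ℕ → A) → Set
HomogeneousSubsequence R s =
  ∃ λ g → StrictlyIncreasing g × (Homogeneous R (s ∘ g) ⊎ Homogeneous (λ x y → ¬ R x y) (s ∘ g))

Homogeneous-∘ : {A : Set} {R : A → A → Set} {s : ℕ → A} {g : ℕ → ℕ} →
                Homogeneous R s → StrictlyIncreasing g → Homogeneous R (s ∘ g)
Homogeneous-∘ hom g↑ = hom ∘ g↑

increasing-by-steps : (h : ℕ → ℕ) → (∀ k → h k < h (suc k)) → StrictlyIncreasing h
increasing-by-steps h step = go ∘ <⇒<′
  where
  go : ∀ {i j} → i <′ j → h i < h j
  go ≤′-refl = step _
  go (≤′-step i<′j) = <-trans (go i<′j) (step _)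

Literal : {A : Set} → Bool → Pred A 0ℓ → Pred A 0ℓ
Literal true Q = Q
Literal false Q = ∁ Q

Inf-U : Inf {0ℓ} U
Inf-U (i , finitely-often) = finitely-often i ≤-refl tt

Inf-above : ∀ {X : Pred ℕ 0ℓ} → Inf X → ∀ a → Inf ((a <_) ∩ X)
Inf-above inf a (i , finitely-often) =
  inf (suc a ⊔ i , λ j bound xj →
    finitely-often j (m⊔n≤o⇒n≤o (suc a) i bound) (m⊔n≤o⇒m≤o (suc a) i bound , xj))

module _ (em : ExcludedMiddle 0ℓ) where

  private
    dne = em⇒dne em

  Inf-witness : ∀ {X : Pred ℕ 0ℓ} → Inf X → ∀ n → ∃ λ m → n ≤ m × X m
  Inf-witness inf n = dne λ none → inf (n , λ m n≤m xm → none (m , n≤m , xm))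

  Inf⇒enumeration : ∀ {X : Pred ℕ 0ℓ} → Inf X → ∃ λ h → StrictlyIncreasing h × (∀ k → X (h k))
  Inf⇒enumeration {X} inf = h , increasing-by-steps h (proj₁ ∘ proj₂ ∘ next) , member
    where
    h : ℕ → ℕ
    next : ∀ k → ∃ λ m → suc (h k) ≤ m × X m
    next k = Inf-witness inf (suc (h k))
    h zero = proj₁ (Inf-witness inf 0)
    h (suc k) = proj₁ (next k)
    member : ∀ k → X (h k)
    member zero = proj₂ (proj₂ (Inf-witness inf 0))
    member (suc k) = proj₂ (proj₂ (next k))

  Inf-split : ∀ {X : Pred ℕ 0ℓ} → Inf X → (Q : Pred ℕ 0ℓ) → ∃ λ b → Inf (X ∩ Literal b Q)
  Inf-split {X} inf Q with dne (commutes-with-∪ {P = X ∩ Q} {Q = X ∩ ∁ Q} (Inf-map decide inf))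
    where
    decide : X ⊆ (X ∩ Q) ∪ (X ∩ ∁ Q)
    decide {m} xm with em {Q m}
    ... | yes q = inj₁ (xm , q)
    ... | no ¬q = inj₂ (xm , ¬q)
  ... | inj₁ inf-Q = true , inf-Q
  ... | inj₂ inf-∁Q = false , inf-∁Q

  bool-pigeonhole : (c : ℕ → Bool) → ∃ λ b → Inf (λ n → c n ≡ b)
  bool-pigeonhole c with b , often ← Inf-split Inf-U (λ n → c n ≡ true) =
    b , Inf-map (value b ∘ proj₂) often
    where
    value : ∀ b {n} → Literal b (λ n → c n ≡ true) n → c n ≡ b
    value true = id
    value false = ¬-not

  -- Stage n + 1 keeps those m > aₙ of stage n for which R (s aₙ) (s m) has a
  -- fixed truth value, the one that holds infinitely often; the apexes aₙ then
  -- form a sequence on which that truth value depends only on the smaller index.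
  module RamseyConstruction {A : Set} (R : A → A → Set) (s : ℕ → A) where

    stage : ℕ → Σ (Pred ℕ 0ℓ) Inf
    apex : ℕ → ℕ
    refinement : ∀ n → ∃ λ b → Inf (((apex n <_) ∩ proj₁ (stage n)) ∩ Literal b (R (s (apex n)) ∘ s))
    apex n = proj₁ (Inf-witness (proj₂ (stage n)) 0)
    refinement n = Inf-split (Inf-above (proj₂ (stage n)) (apex n)) (R (s (apex n)) ∘ s)
    stage zero = U , Inf-U
    stage (suc n) = _ , proj₂ (refinement n)

    colour : ℕ → Bool
    colour n = proj₁ (refinement n)

    apex∈stage : ∀ n → proj₁ (stage n) (apex n)
    apex∈stage n = proj₂ (proj₂ (Inf-witness (proj₂ (stage n)) 0))

    stage-antitone : ∀ {i j m} → i ≤′ j → proj₁ (stage j) m → proj₁ (stage i) m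
    stage-antitone ≤′-refl x = x
    stage-antitone (≤′-step i≤′j) ((_ , x) , _) = stage-antitone i≤′j x

    apex-pair : ∀ {i j} → i < j → apex i < apex j × Literal (colour i) (R (s (apex i)) ∘ s) (apex j)
    apex-pair {j = j} i<j with (ordered , _) , literal ← stage-antitone (<⇒<′ i<j) (apex∈stage j) =
      ordered , literal

    literal-homogeneous : ∀ b {g} → (∀ {i j} → i < j → Literal b (R (s (g i)) ∘ s) (g j)) →
                          Homogeneous R (s ∘ g) ⊎ Homogeneous (λ x y → ¬ R x y) (s ∘ g)
    literal-homogeneous true hom = inj₁ hom
    literal-homogeneous false hom = inj₂ hom

    homogeneous-subsequence : HomogeneousSubsequence R s
    homogeneous-subsequence
      with b , often ← bool-pigeonhole colour
      with idx , idx↑ , idx-colour ← Inf⇒enumeration often =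
      apex ∘ idx , proj₁ ∘ apex-pair ∘ idx↑ ,
      literal-homogeneous b λ {i} i<j →
        subst (λ c → Literal c (R (s (apex (idx i))) ∘ s) _) (idx-colour i)
              (proj₂ (apex-pair (idx↑ i<j)))

  -- Abstract, so that type checking never unfolds the classical construction.
  abstract
    ramsey : {A : Set} (R : A → A → Set) (s : ℕ → A) → HomogeneousSubsequence R s
    ramsey = RamseyConstruction.homogeneous-subsequence

  fresh-sequence : {A : Set} {R : A → A → Set} →
                   ¬ (Σ (List A) λ L → (v : A) → Any (R v) L) →
                   ∃ λ f → Homogeneous (λ x y → ¬ R y x) f
  fresh-sequence {A} {R} uncoverable = f , λ {i} {j} i<j r →
    proj₂ (fresh (prefix j)) (Any.map (λ eq → subst (R (f j)) eq r) (∈-prefix (<⇒<′ i<j)))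
    where
    fresh : (L : List A) → ∃ λ v → ¬ Any (R v) L
    fresh L = dne λ none → uncoverable (L , λ v → dne λ ¬any → none (v , ¬any))
    f : ℕ → A
    prefix : ℕ → List A
    f n = proj₁ (fresh (prefix n))
    prefix zero = []
    prefix (suc n) = f n ∷ prefix n
    ∈-prefix : ∀ {i j} → i <′ j → f i ∈ prefix j
    ∈-prefix ≤′-refl = here refl
    ∈-prefix (≤′-step i<′j) = there (∈-prefix i<′j)

Image : {A : Set} → (ℕ → A) → A → Set
Image s v = ∃ λ i → s i ≡ v

PairwiseOn : {A : Set} → (A → Set) → (A → A → Set) → Set
PairwiseOn P R = ∀ x y → P x → P y → x ≢ y → R x y

Image-infinite : {A : Set} {s : ℕ → A} → Injective _≡_ _≡_ s → Infinite (Image s)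
Image-infinite {s = s} s-injective (L , covers) =
  collision-free (pigeonhole (n<1+n (length L)) (index ∘ position))
  where
  position : ∀ k → s (toℕ k) ∈ L
  position k = covers _ (toℕ k , refl)
  collision-free : ¬ ∃₂ λ i j → i Fin.< j × index (position i) ≡ index (position j)
  collision-free (i , j , i<j , same) =
    <-irrefl (s-injective (trans (lookup-index (position i))
                                 (trans (cong (lookup L) same) (sym (lookup-index (position j)))))) i<j

image-pairwise : {A : Set} {R : A → A → Set} {s : ℕ → A} →
                 Symmetric R → Homogeneous R s → PairwiseOn (Image s) R
image-pairwise R-sym hom _ _ (i , refl) (j , refl) si≢sj with <-cmp i j
... | tri< i<j _ _ = hom i<j
... | tri≈ _ refl _ = contradiction refl si≢sj
... | tri> _ _ j<i = R-sym (hom j<i)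

apart⇒injective : {A : Set} {R : A → A → Set} {s : ℕ → A} →
                  Reflexive R → Homogeneous (λ x y → ¬ R x y) s → Injective _≡_ _≡_ s
apart⇒injective {R = R} {s} R-refl apart {i} {j} si≡sj with <-cmp i j
... | tri< i<j _ _ = contradiction (subst (R (s i)) si≡sj R-refl) (apart i<j)
... | tri≈ _ i≡j _ = i≡j
... | tri> _ _ j<i = contradiction (subst (R (s j)) (sym si≡sj) R-refl) (apart j<i)

double : ℕ → ℕ
double zero = zero
double (suc n) = suc (suc (double n))

odd<double : ∀ {i j} → i < j → suc (double i) < double j
odd<double {zero} {suc j} _ = s≤s (s≤s z≤n)
odd<double {suc i} {suc j} (s≤s i<j) = s≤s (s≤s (odd<double i<j))

double-increasing : StrictlyIncreasing double
double-increasing i<j = <-trans (n<1+n _) (odd<double i<j)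

double≢odd : ∀ i j → double i ≢ suc (double j)
double≢odd zero j ()
double≢odd (suc i) zero ()
double≢odd (suc i) (suc j) eq = double≢odd i j (suc-injective (suc-injective eq))

module OrderedDigraphProperties {V : Set} (_≤_ : V → V → Set) (ρ : V → V → Set) where
  open OrderedDigraph _≤_ ρ

  SameType : V → V → V → V → Set
  SameType x y x′ y′ =
    ((x ≤ y → x′ ≤ y′) × (x′ ≤ y′ → x ≤ y)) × ((ρ x y → ρ x′ y′) × (ρ x′ y′ → ρ x y))

  SameType-refl : ∀ {x y} → SameType x y x y
  SameType-refl = (id , id) , (id , id)

  SameType-swap : ∀ {x y x′ y′} → SameType x y x′ y′ → SameType x′ y′ x y
  SameType-swap ((≤⇒ , ⇐≤) , (ρ⇒ , ⇐ρ)) = (⇐≤ , ≤⇒) , (⇐ρ , ρ⇒)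

  IsoRestr-sym : ∀ {n} (u w : Vec V n) → IsoRestr u w → IsoRestr w u
  IsoRestr-sym _ w (σ , same) = ↔-sym σ , λ i j →
    SameType-swap (subst₂ (λ a b → SameType _ _ (Vec.lookup w a) (Vec.lookup w b))
                          (strictlyInverseˡ i) (strictlyInverseˡ j) (same (from i) (from j)))
    where open Inverse σ

  KEquiv-sym : ∀ {k} → Symmetric (KEquiv k)
  KEquiv-sym {x = x} {y} x≃y F distinct avoids =
    IsoRestr-sym (x ∷ F) (y ∷ F) (x≃y F distinct (swap ∘ avoids))

  Equiv-refl : Reflexive Equiv
  Equiv-refl k F _ _ = ↔-refl , λ _ _ → SameType-refl

  Equiv-sym : Symmetric Equiv
  Equiv-sym x≃y k = KEquiv-sym (x≃y k)

  KEquiv-zero : Reflexive _≤_ → (∀ x → ρ x x) ⊎ (∀ x → ¬ ρ x x) → ∀ x y → KEquiv 0 x y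
  KEquiv-zero ≤-refl loops x y [] _ _ =
    ↔-refl , λ { Fin.zero Fin.zero → (const ≤-refl , const ≤-refl) , same-loop loops }
    where
    same-loop : (∀ x → ρ x x) ⊎ (∀ x → ¬ ρ x x) → (ρ x x → ρ y y) × (ρ y y → ρ x x)
    same-loop (inj₁ loop) = const (loop y) , const (loop x)
    same-loop (inj₂ no-loop) = ⊥-elim ∘ no-loop x , ⊥-elim ∘ no-loop y

  Interval-sym : ∀ {x y z} → Interval x y z → Interval y x z
  Interval-sym = Sum.swap

  Monotonic : (ℕ → V) → Set
  Monotonic s = Homogeneous _≤_ s ⊎ Homogeneous (λ x y → ¬ x ≤ y) s

  Monotonic-∘ : ∀ {s g} → Monotonic s → StrictlyIncreasing g → Monotonic (s ∘ g)
  Monotonic-∘ {s} (inj₁ up) g↑ = inj₁ (Homogeneous-∘ {R = _≤_} {s} up g↑)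
  Monotonic-∘ {s} (inj₂ down) g↑ = inj₂ (Homogeneous-∘ {R = λ x y → ¬ x ≤ y} {s} down g↑)

  monotonic⇒between :
    Total _≤_ → ∀ {s a b c} → Monotonic s → a < b → b < c → Interval (s a) (s c) (s b)
  monotonic⇒between total (inj₁ up) a<b b<c = inj₁ (up a<b , up b<c)
  monotonic⇒between total (inj₂ down) a<b b<c = inj₂ (≰⇒≥ (down b<c) , ≰⇒≥ (down a<b))
    where
    ≰⇒≥ : ∀ {x y} → ¬ x ≤ y → y ≤ x
    ≰⇒≥ {x} {y} x≰y = Sum.[ (λ x≤y → contradiction x≤y x≰y) , id ] (total x y)

  Inequivalent : (ℕ → V) → Set
  Inequivalent = Homogeneous (λ x y → ¬ Equiv x y)

  inequivalent-subsequence-infinite :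
    ∀ {s} → Inequivalent s → ∀ {h} → StrictlyIncreasing h → Infinite (Image (s ∘ h))
  inequivalent-subsequence-infinite {s} apart {h} h↑ =
    Image-infinite (apart⇒injective {R = Equiv} Equiv-refl
                     (Homogeneous-∘ {R = λ x y → ¬ Equiv x y} {s} apart h↑))

  ZeroNotOneEquivalent : V → V → Set
  ZeroNotOneEquivalent x y = KEquiv 0 x y × ¬ KEquiv 1 x y

  ZeroNotOneEquivalent-sym : Symmetric ZeroNotOneEquivalent
  ZeroNotOneEquivalent-sym (x≃₀y , x≄₁y) = KEquiv-sym x≃₀y , x≄₁y ∘ KEquiv-sym

  OneNotEquivalentSeparatedBy : (V → Set) → V → V → Set
  OneNotEquivalentSeparatedBy A x y = (KEquiv 1 x y × ¬ Equiv x y) × (∃ λ z → A z × Interval x y z)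

  OneNotEquivalentSeparatedBy-sym : ∀ {A} → Symmetric (OneNotEquivalentSeparatedBy A)
  OneNotEquivalentSeparatedBy-sym ((x≃₁y , x≄y) , z , z∈A , between) =
    (KEquiv-sym x≃₁y , x≄y ∘ Equiv-sym) , z , z∈A , Interval-sym between

  zero-not-one-equivalent-set :
    Reflexive _≤_ → (∀ x → ρ x x) ⊎ (∀ x → ¬ ρ x x) →
    ∀ {s} → Inequivalent s → Homogeneous (λ x y → ¬ KEquiv 1 x y) s →
    Σ (V → Set) λ A → Infinite A × PairwiseOn A ZeroNotOneEquivalent
  zero-not-one-equivalent-set ≤-refl loops apart not-one =
    Image _ , inequivalent-subsequence-infinite apart id ,
    image-pairwise ZeroNotOneEquivalent-sym λ i<j → KEquiv-zero ≤-refl loops _ _ , not-one i<j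

  interleaved-one-equivalent-sets :
    Total _≤_ → ∀ {s} → Inequivalent s → Monotonic s → Homogeneous (KEquiv 1) s →
    Σ (V → Set) λ A₁ → Σ (V → Set) λ A₂ →
      Disjoint A₁ A₂ × Infinite A₁ × Infinite A₂ ×
      PairwiseOn A₁ (OneNotEquivalentSeparatedBy A₂) × PairwiseOn A₂ (OneNotEquivalentSeparatedBy A₁)
  interleaved-one-equivalent-sets total {s} apart mono one =
    Image evens , Image odds , disjoint ,
    inequivalent-subsequence-infinite apart double-increasing ,
    inequivalent-subsequence-infinite apart (s≤s ∘ double-increasing) ,
    image-pairwise OneNotEquivalentSeparatedBy-sym
      (λ {i} i<j → properties (double-increasing i<j) , odds i , (i , refl) ,
                   monotonic⇒between total mono (n<1+n _) (odd<double i<j)) ,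
    image-pairwise OneNotEquivalentSeparatedBy-sym
      (λ {i} i<j → properties (s≤s (double-increasing i<j)) , evens (suc i) , (suc i , refl) ,
                   monotonic⇒between total mono (n<1+n _) (s≤s (odd<double i<j)))
    where
    evens odds : ℕ → V
    evens = s ∘ double
    odds = s ∘ suc ∘ double
    properties : ∀ {i j} → i < j → KEquiv 1 (s i) (s j) × ¬ Equiv (s i) (s j)
    properties i<j = one i<j , apart i<j
    disjoint : Disjoint (Image evens) (Image odds)
    disjoint _ (i , refl) (j , same) =
      double≢odd i j (apart⇒injective {R = Equiv} {s} Equiv-refl apart (sym same))

mainTheorem8 : ExcludedMiddle 0ℓ →
    (V : Set) (_≤_ : V → V → Set) (ρ : V → V → Set) →
    IsTotalOrder _≡_ _≤_ →
    ((∀ x → ρ x x) ⊎ (∀ x → ¬ ρ x x)) →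
    OrderedDigraph.InfinitelyManyClasses _≤_ ρ →
    (Σ (V → Set) λ A → Infinite A ×
       (∀ x y → A x → A y → x ≢ y →
          OrderedDigraph.KEquiv _≤_ ρ 0 x y × ¬ OrderedDigraph.KEquiv _≤_ ρ 1 x y))
    ⊎
    (Σ (V → Set) λ A₁ → Σ (V → Set) λ A₂ →
       Disjoint A₁ A₂ × Infinite A₁ × Infinite A₂ ×
       (∀ x y → A₁ x → A₁ y → x ≢ y →
          (OrderedDigraph.KEquiv _≤_ ρ 1 x y × ¬ OrderedDigraph.Equiv _≤_ ρ x y) ×
          (∃ λ z → A₂ z × OrderedDigraph.Interval _≤_ ρ x y z)) ×
       (∀ x y → A₂ x → A₂ y → x ≢ y →
          (OrderedDigraph.KEquiv _≤_ ρ 1 x y × ¬ OrderedDigraph.Equiv _≤_ ρ x y) ×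
          (∃ λ z → A₁ z × OrderedDigraph.Interval _≤_ ρ x y z)))
mainTheorem8 em V _≤_ ρ order loops many-classes
  with f , f-fresh ← fresh-sequence em many-classes
  with g₁ , g₁↑ , f∘g₁-monotonic ← ramsey em _≤_ f
  with g₂ , g₂↑ , one-or-none ← ramsey em (OrderedDigraph.KEquiv _≤_ ρ 1) (f ∘ g₁)
  = Sum.map (zero-not-one-equivalent-set ≤-reflexive loops apart)
            (interleaved-one-equivalent-sets total apart (Monotonic-∘ f∘g₁-monotonic g₂↑))
            (Sum.swap one-or-none)
  where
  open OrderedDigraph _≤_ ρ
  open OrderedDigraphProperties _≤_ ρ
  open IsTotalOrder order using (total) renaming (refl to ≤-reflexive)
  apart : Inequivalent ((f ∘ g₁) ∘ g₂)
  apart = Homogeneous-∘ {R = λ x y → ¬ Equiv x y} {f ∘ g₁}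
            (Homogeneous-∘ {R = λ x y → ¬ Equiv x y} {f} (λ i<j → f-fresh i<j ∘ Equiv-sym) g₁↑) g₂↑
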